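{- Let $\mathcal T=(3^3,4^2)$ be the semi-regular edge-to-edge tessellation of the plane (the elongated triangular tiling) in which every vertex is surrounded, in cyclic order, by three equilateral triangles and two squares. Then its half-domination density satisfies $$\rho_{(3^3,4^2)}\le \frac{13}{21}.$$
   Context: The tessellation $\mathcal T=(3^3,4^2)$ consists of horizontal rows of unit squares alternating with horizontal rows of unit equilateral triangles, all tiles being edge-to-edge; it is periodic: a minimal cluster consisting of one square and two equilateral triangles, translated by all integer combinations of two vectors $v_1,v_2$, tiles the plane. For $m,n\in\mathbb N$, let $G_{\mathcal T,m,n}$ be the graph whose vertices are the tiles of the region formed by $m$ copies of the minimal cluster in the direction $v_1$ and $n$ copies in the direction $v_2$ (i.e. translates by $a v_1+b v_2$, $0\le a<m$, $0\le b<n$), two tiles being adjacent iff they share a common edge. For a vertex $v$ let $d(v)$ be its degree. A set $S$ of vertices is half-dependent if every $v\in S$ has at most $\lfloor d(v)/2\rfloor$ neighbors in $S$. Let $\rho_{\mathcal T,m,n}$ be the maximum cardinality of a half-dependent set in $G_{\mathcal T,m,n}$ divided by the number of vertices of $G_{\mathcal T,m,n}$, and define the half-domination density $\rho_{\mathcal T}=\limsup_{m,n\to\infty}\rho_{\mathcal T,m,n}$. -}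

module Defs where

open import Data.Nat using (ℕ; zero; suc; _+_; _*_; _≤_; _≡ᵇ_; _/_)
open import Data.Bool using (Bool; true; false; _∧_; _∨_)
open import Data.List using (List; []; _∷_; length; filter; map; concatMap; upTo)
open import Data.List.Membership.Propositional using (_∈_)
open import Data.Product using (_×_; _,_)
open import Relation.Binary.PropositionalEquality using (_≡_)
open import Relation.Nullary.Decidable using (Dec)
open import Data.Bool using (T)
open import Data.Bool.Properties using (T?)

-- The minimal cluster at translate a·v1 + b·v2 (a,b ∈ ℤ) consists of
--   sq a b : the unit square,
--   up a b : the upward triangle sitting on the top edge of that square,
--   dn a b : the downward triangle immediately to the right of (up a b).
-- Here v1 = (1,0) and v2 = (1/2, 1 + √3/2).
data Kind : Set where
  sq up dn : Kind

Tile : Set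
Tile = Kind × ℕ × ℕ

-- One-directional edge-sharing relation (every shared edge appears once):
--   sq a b  – sq (a+1) b   (vertical edge inside a square row)
--   sq a b  – up a b       (top edge of the square)
--   up a b  – dn a b       (right edge of the up triangle)
--   dn a b  – up (a+1) b   (right edge of the down triangle)
--   dn a b  – sq a (b+1)   (top edge of the down triangle = bottom of next square)
adj' : Tile → Tile → Bool
adj' (sq , a , b) (sq , a' , b') = (a' ≡ᵇ suc a) ∧ (b' ≡ᵇ b)
adj' (sq , a , b) (up , a' , b') = (a' ≡ᵇ a) ∧ (b' ≡ᵇ b)
adj' (up , a , b) (dn , a' , b') = (a' ≡ᵇ a) ∧ (b' ≡ᵇ b)
adj' (dn , a , b) (up , a' , b') = (a' ≡ᵇ suc a) ∧ (b' ≡ᵇ b)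
adj' (dn , a , b) (sq , a' , b') = (a' ≡ᵇ a) ∧ (b' ≡ᵇ suc b)
adj' _ _ = false

adj : Tile → Tile → Bool
adj t u = adj' t u ∨ adj' u t

tiles : ℕ → ℕ → List Tile
tiles m n = concatMap (λ a → concatMap (λ b → (sq , a , b) ∷ (up , a , b) ∷ (dn , a , b) ∷ []) (upTo n)) (upTo m)

count : {A : Set} → (A → Bool) → List A → ℕ
count p xs = length (filter (λ x → T? (p x)) xs)

degree : ℕ → ℕ → Tile → ℕ
degree m n t = count (adj t) (tiles m n)

HalfDependent : ℕ → ℕ → (Tile → Bool) → Set
HalfDependent m n S =
  ∀ t → t ∈ tiles m n → S t ≡ true →
    count (λ u → adj t u ∧ S u) (tiles m n) ≤ degree m n t / 2

card : ℕ → ℕ → (Tile → Bool) → ℕ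
card m n S = count S (tiles m n)

-- Discharging.  Give each cluster (square, up triangle, down triangle) the charge
-- 21·|S ∩ cluster| and let it send flow across the three edges leaving it to the right
-- (square–square, down–up) and upwards (down triangle–square), the amount depending
-- only on which of the tiles at that edge lie in S.  Using only the half-dependence
-- constraints at squares and up triangles, a finite check shows that every cluster
-- ends with at most 39 = 13·3.  Summing over the m × n clusters the interior flows
-- cancel, and the flow entering through the left and bottom boundaries contributes
-- only O(m + n); hence 21·|S| ≤ 39mn + 15n + 8m while the graph has 3mn vertices.
module Submission where

open import Defs
open import Data.Nat using (ℕ; suc; _+_; _*_; _≤_; _≥_)
open import Data.Bool using (Bool)
open import Data.Product using (∃-syntax)
open import Data.List using (length)

open import Data.Bool using (true; false; _∧_; _∨_; T)
open import Data.Bool.Properties using (T?; T-∧; T-≡; ∧-assoc; ∧-identityʳ; ∧-distribʳ-∨)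
open import Data.Empty using (⊥; ⊥-elim)
open import Data.List using (List; []; _∷_; _++_; map; filter; concatMap; applyUpTo)
open import Data.List.Membership.Propositional using (_∈_)
open import Data.List.Membership.Propositional.Properties using (∈-concatMap⁺; ∈-applyUpTo⁺)
open import Data.List.Properties using (filter-++; length-++; map-cong; map-++)
open import Data.List.Relation.Unary.Any using (here; there)
import Data.List.Relation.Unary.Any as Any
open import Data.Nat using (zero; _<_; _≡ᵇ_; _<ᵇ_; _/_; z≤n; s≤s)
open import Data.Nat.DivMod using (/-monoˡ-≤)
open import Data.Nat.ListAction using (sum)
open import Data.Nat.ListAction.Properties using (sum-++)
open import Data.Nat.Properties
open import Algebra.Properties.CommutativeSemigroup +-commutativeSemigroup using (interchange)
open import Data.Nat.Tactic.RingSolver using (solve)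
open import Data.Product using (_×_; _,_; proj₁; proj₂)
open import Function using (_∘_; Equivalence)
open import Relation.Binary.PropositionalEquality
open import Relation.Nullary.Decidable using (Dec; map′; _×-dec_; _→-dec_; from-yes)

open Equivalence using (to)

∑< : ℕ → (ℕ → ℕ) → ℕ
∑< zero    f = 0
∑< (suc n) f = f 0 + ∑< n (f ∘ suc)

syntax ∑< n (λ i → e) = ∑[ i < n ] e

∑-zero : ∀ n → ∑[ i < n ] 0 ≡ 0
∑-zero zero    = refl
∑-zero (suc n) = ∑-zero n

∑-cong : ∀ n {f g : ℕ → ℕ} → (∀ i → i < n → f i ≡ g i) → ∑< n f ≡ ∑< n g
∑-cong zero    eq = refl
∑-cong (suc n) eq = cong₂ _+_ (eq 0 (s≤s z≤n)) (∑-cong n (λ i i<n → eq (suc i) (s≤s i<n)))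

∑-mono : ∀ n {f g : ℕ → ℕ} → (∀ i → f i ≤ g i) → ∑< n f ≤ ∑< n g
∑-mono zero    le = z≤n
∑-mono (suc n) le = +-mono-≤ (le 0) (∑-mono n (le ∘ suc))

∑-+ : ∀ n (f g : ℕ → ℕ) → ∑[ i < n ] (f i + g i) ≡ ∑< n f + ∑< n g
∑-+ zero    f g = refl
∑-+ (suc n) f g = trans (cong (f 0 + g 0 +_) (∑-+ n (f ∘ suc) (g ∘ suc)))
                        (interchange (f 0) (g 0) _ _)

∑-const : ∀ n c → ∑[ i < n ] c ≡ n * c
∑-const zero    c = refl
∑-const (suc n) c = cong (c +_) (∑-const n c)

∑-*ˡ : ∀ n c (f : ℕ → ℕ) → ∑[ i < n ] (c * f i) ≡ c * ∑< n f
∑-*ˡ zero    c f = sym (*-zeroʳ c)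
∑-*ˡ (suc n) c f = trans (cong (c * f 0 +_) (∑-*ˡ n c (f ∘ suc))) (sym (*-distribˡ-+ c (f 0) _))

∑-≤-shift : ∀ n (f : ℕ → ℕ) → ∑< n f ≤ f 0 + ∑[ i < n ] f (suc i)
∑-≤-shift zero    f = z≤n
∑-≤-shift (suc n) f = +-monoʳ-≤ (f 0) (∑-≤-shift n (f ∘ suc))

∑-sum-comm : ∀ {A : Set} n (f : A → ℕ → ℕ) (xs : List A) →
  ∑[ i < n ] sum (map (λ x → f x i) xs) ≡ sum (map (λ x → ∑< n (f x)) xs)
∑-sum-comm n f []       = ∑-zero n
∑-sum-comm n f (x ∷ xs) = trans (∑-+ n (f x) _) (cong (∑< n (f x) +_) (∑-sum-comm n f xs))

ind : Bool → ℕ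
ind true  = 1
ind false = 0

ind≤1 : ∀ x → ind x ≤ 1
ind≤1 true  = ≤-refl
ind≤1 false = z≤n

count-as-sum : ∀ {A : Set} (p : A → Bool) xs → count p xs ≡ sum (map (ind ∘ p) xs)
count-as-sum p []       = refl
count-as-sum p (x ∷ xs) with p x
... | true  = cong suc (count-as-sum p xs)
... | false = count-as-sum p xs

count-cong : ∀ {A : Set} {p q : A → Bool} → (∀ x → p x ≡ q x) → ∀ xs → count p xs ≡ count q xs
count-cong {p = p} {q} eq xs = begin
  count p xs                ≡⟨ count-as-sum p xs ⟩
  sum (map (ind ∘ p) xs)    ≡⟨ cong sum (map-cong (cong ind ∘ eq) xs) ⟩
  sum (map (ind ∘ q) xs)    ≡⟨ count-as-sum q xs ⟨
  count q xs                ∎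
  where open ≡-Reasoning

count-++ : ∀ {A : Set} (p : A → Bool) xs ys → count p (xs ++ ys) ≡ count p xs + count p ys
count-++ p xs ys = trans (cong length (filter-++ (T? ∘ p) xs ys)) (length-++ (filter (T? ∘ p) xs))

count-true : ∀ {A : Set} (xs : List A) → count (λ _ → true) xs ≡ length xs
count-true []       = refl
count-true (x ∷ xs) = cong suc (count-true xs)

sum-map-ind≤length : ∀ {A : Set} (p : A → Bool) xs → sum (map (ind ∘ p) xs) ≤ length xs
sum-map-ind≤length p []       = z≤n
sum-map-ind≤length p (x ∷ xs) = +-mono-≤ (ind≤1 (p x)) (sum-map-ind≤length p xs)

count-∨ : ∀ {A : Set} {p q : A → Bool} → (∀ x → T (p x) → T (q x) → ⊥) →
  ∀ xs → count (λ x → p x ∨ q x) xs ≡ count p xs + count q xs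
count-∨             excl []       = refl
count-∨ {p = p} {q} excl (x ∷ xs) with p x | q x | excl x
... | true  | true  | ex = ⊥-elim (ex _ _)
... | true  | false | _  = cong suc (count-∨ excl xs)
... | false | true  | _  = trans (cong suc (count-∨ excl xs)) (sym (+-suc (count p xs) (count q xs)))
... | false | false | _  = count-∨ excl xs

count-concatMap : ∀ {A : Set} (p : A → Bool) (f : ℕ → List A) (g : ℕ → ℕ) n →
  count p (concatMap f (applyUpTo g n)) ≡ ∑[ i < n ] count p (f (g i))
count-concatMap p f g zero    = refl
count-concatMap p f g (suc n) =
  trans (count-++ p (f (g 0)) _) (cong (count p (f (g 0)) +_) (count-concatMap p f (g ∘ suc) n))

kinds : List Kind
kinds = sq ∷ up ∷ dn ∷ []

cluster : ℕ → ℕ → List Tile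
cluster a b = map (λ k → (k , a , b)) kinds

count-tiles : ∀ m n (p : Tile → Bool) →
  count p (tiles m n) ≡ ∑[ a < m ] ∑[ b < n ] count p (cluster a b)
count-tiles m n p = trans (count-concatMap p _ (λ i → i) m)
  (∑-cong m (λ a _ → count-concatMap p (cluster a) (λ i → i) n))

count-tiles-by-kind : ∀ m n (p : Tile → Bool) →
  count p (tiles m n) ≡ sum (map (λ k → ∑[ a < m ] ∑[ b < n ] ind (p (k , a , b))) kinds)
count-tiles-by-kind m n p = begin
  count p (tiles m n)
    ≡⟨ count-tiles m n p ⟩
  ∑[ a < m ] ∑[ b < n ] count p (cluster a b)
    ≡⟨ ∑-cong m (λ a _ → ∑-cong n (λ b _ → count-as-sum p (cluster a b))) ⟩
  ∑[ a < m ] ∑[ b < n ] sum (map (λ k → ind (p (k , a , b))) kinds)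
    ≡⟨ ∑-cong m (λ a _ → ∑-sum-comm n (λ k b → ind (p (k , a , b))) kinds) ⟩
  ∑[ a < m ] sum (map (λ k → ∑[ b < n ] ind (p (k , a , b))) kinds)
    ≡⟨ ∑-sum-comm m (λ k a → ∑[ b < n ] ind (p (k , a , b))) kinds ⟩
  sum (map (λ k → ∑[ a < m ] ∑[ b < n ] ind (p (k , a , b))) kinds) ∎
  where open ≡-Reasoning

length-tiles : ∀ m n → length (tiles m n) ≡ m * (n * 3)
length-tiles m n = begin
  length (tiles m n)                  ≡⟨ count-true (tiles m n) ⟨
  count (λ _ → true) (tiles m n)      ≡⟨ count-tiles m n (λ _ → true) ⟩
  ∑[ a < m ] ∑[ b < n ] 3             ≡⟨ ∑-cong m (λ _ _ → ∑-const n 3) ⟩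
  ∑[ a < m ] (n * 3)                  ≡⟨ ∑-const m (n * 3) ⟩
  m * (n * 3)                         ∎
  where open ≡-Reasoning

∈-tiles : ∀ m n k {a b} → a < m → b < n → (k , a , b) ∈ tiles m n
∈-tiles m n k {a} {b} a<m b<n =
  ∈-concatMap⁺ _ (Any.map (λ { refl → ∈-concatMap⁺ _ (Any.map (λ { refl → ∈-cluster k })
                                                               (∈-applyUpTo⁺ _ b<n)) })
                          (∈-applyUpTo⁺ _ a<m))
  where
  ∈-cluster : ∀ k → (k , a , b) ∈ cluster a b
  ∈-cluster sq = here refl
  ∈-cluster up = there (here refl)
  ∈-cluster dn = there (there (here refl))

-- `occupied m n P (k , c , d)` says that (k , c - 1 , d - 1) is a vertex of G_{m,n} in P;
-- the shift makes the left and lower neighbours of tiles in column or row 0 expressible,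
-- the coordinate 0 standing for a position outside the region.
slot : ℕ → (ℕ → Bool) → ℕ → Bool
slot n h zero    = false
slot n h (suc i) = (i <ᵇ n) ∧ h i

occupied : ℕ → ℕ → (Tile → Bool) → Tile → Bool
occupied m n P (k , c , d) = slot m (λ a → slot n (λ b → P (k , a , b)) d) c

occupied-inside : ∀ m n (P : Tile → Bool) k {a b} → a < m → b < n →
  occupied m n P (k , suc a , suc b) ≡ P (k , a , b)
occupied-inside m n P k a<m b<n
  rewrite to T-≡ (<⇒<ᵇ a<m) | to T-≡ (<⇒<ᵇ b<n) = refl

occupied⇒ : ∀ m n (P : Tile → Bool) k a b → T (occupied m n P (k , suc a , suc b)) →
  a < m × b < n × P (k , a , b) ≡ true
occupied⇒ m n P k a b occ =
  <ᵇ⇒< a m (proj₁ a<m,rest) , <ᵇ⇒< b n (proj₁ b<n,Pt) , to T-≡ (proj₂ b<n,Pt)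
  where
  a<m,rest : T (a <ᵇ m) × T ((b <ᵇ n) ∧ P (k , a , b))
  a<m,rest = to T-∧ occ
  b<n,Pt : T (b <ᵇ n) × T (P (k , a , b))
  b<n,Pt = to T-∧ (proj₂ a<m,rest)

∑-slot : ∀ n c (h : ℕ → Bool) → ∑[ i < n ] ind ((suc i ≡ᵇ c) ∧ h i) ≡ ind (slot n h c)
∑-slot zero    zero          h = refl
∑-slot zero    (suc c)       h = refl
∑-slot (suc n) zero          h = ∑-slot n zero (h ∘ suc)
∑-slot (suc n) (suc zero)    h = trans (cong (ind (h 0) +_) (∑-slot n zero (h ∘ suc))) (+-identityʳ _)
∑-slot (suc n) (suc (suc c)) h = ∑-slot n (suc c) (h ∘ suc)

∑-guard : ∀ n x (g : ℕ → Bool) {y} → ∑< n (ind ∘ g) ≡ ind y → ∑[ i < n ] ind (x ∧ g i) ≡ ind (x ∧ y)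
∑-guard n true  g eq = eq
∑-guard n false g eq = ∑-zero n

∑∑-site : ∀ m n (P : Tile → Bool) {k} c d {test : ℕ → ℕ → Bool} →
  (∀ a b → test a b ≡ (suc a ≡ᵇ c) ∧ (suc b ≡ᵇ d)) →
  ∑[ a < m ] ∑[ b < n ] ind (test a b ∧ P (k , a , b)) ≡ ind (occupied m n P (k , c , d))
∑∑-site m n P {k} c d {test} eq = begin
  ∑[ a < m ] ∑[ b < n ] ind (test a b ∧ P (k , a , b))
    ≡⟨ ∑-cong m (λ a _ → ∑-cong n (λ b _ → cong ind (reassociate a b))) ⟩
  ∑[ a < m ] ∑[ b < n ] ind ((suc a ≡ᵇ c) ∧ ((suc b ≡ᵇ d) ∧ P (k , a , b)))
    ≡⟨ ∑-cong m (λ a _ → ∑-guard n (suc a ≡ᵇ c) _ (∑-slot n d (λ b → P (k , a , b)))) ⟩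
  ∑[ a < m ] ind ((suc a ≡ᵇ c) ∧ slot n (λ b → P (k , a , b)) d)
    ≡⟨ ∑-slot m c _ ⟩
  ind (occupied m n P (k , c , d)) ∎
  where
  open ≡-Reasoning
  reassociate : ∀ a b → (test a b ∧ P (k , a , b)) ≡ ((suc a ≡ᵇ c) ∧ ((suc b ≡ᵇ d) ∧ P (k , a , b)))
  reassociate a b = trans (cong (_∧ P (k , a , b)) (eq a b)) (∧-assoc (suc a ≡ᵇ c) (suc b ≡ᵇ d) (P (k , a , b)))

-- In the shifted coordinates of `occupied`, listed by kind (sq, up, dn) as in
-- count-tiles-by-kind, so that count-out and count-in below need no rearranging.
outNeighbours inNeighbours neighbours : Tile → List Tile
outNeighbours (sq , a , b) = (sq , suc (suc a) , suc b) ∷ (up , suc a , suc b) ∷ []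
outNeighbours (up , a , b) = (dn , suc a , suc b) ∷ []
outNeighbours (dn , a , b) = (sq , suc a , suc (suc b)) ∷ (up , suc (suc a) , suc b) ∷ []
inNeighbours  (sq , a , b) = (sq , a , suc b) ∷ (dn , suc a , b) ∷ []
inNeighbours  (up , a , b) = (sq , suc a , suc b) ∷ (dn , a , suc b) ∷ []
inNeighbours  (dn , a , b) = (up , suc a , suc b) ∷ []
neighbours t = outNeighbours t ++ inNeighbours t

≡ᵇ-comm : ∀ a b → (a ≡ᵇ b) ≡ (b ≡ᵇ a)
≡ᵇ-comm zero    zero    = refl
≡ᵇ-comm zero    (suc b) = refl
≡ᵇ-comm (suc a) zero    = refl
≡ᵇ-comm (suc a) (suc b) = ≡ᵇ-comm a b

∧-≡ᵇ-comm : ∀ a b c d → ((a ≡ᵇ b) ∧ (c ≡ᵇ d)) ≡ ((b ≡ᵇ a) ∧ (d ≡ᵇ c))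
∧-≡ᵇ-comm a b c d = cong₂ _∧_ (≡ᵇ-comm a b) (≡ᵇ-comm c d)

≡ᵇ∧⇒≡ : ∀ a b {z} → T ((a ≡ᵇ b) ∧ z) → a ≡ b
≡ᵇ∧⇒≡ a b p = ≡ᵇ⇒≡ a b (proj₁ (to T-∧ p))

adj'-asym : ∀ t u → T (adj' t u) → T (adj' u t) → ⊥
adj'-asym (sq , a , b) (sq , a′ , b′) tu ut =
  <-asym (≤-reflexive (sym (≡ᵇ∧⇒≡ a′ (suc a) tu))) (≤-reflexive (sym (≡ᵇ∧⇒≡ a (suc a′) ut)))
adj'-asym (up , a , b) (dn , a′ , b′) tu ut =
  1+n≢n (sym (trans (≡ᵇ∧⇒≡ a (suc a′) ut) (cong suc (≡ᵇ∧⇒≡ a′ a tu))))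
adj'-asym (dn , a , b) (up , a′ , b′) tu ut =
  1+n≢n (sym (trans (≡ᵇ∧⇒≡ a′ (suc a) tu) (cong suc (≡ᵇ∧⇒≡ a a′ ut))))
adj'-asym (sq , _) (up , _) _ ()
adj'-asym (sq , _) (dn , _) ()
adj'-asym (up , _) (sq , _) ()
adj'-asym (up , _) (up , _) ()
adj'-asym (dn , _) (sq , _) _ ()
adj'-asym (dn , _) (dn , _) ()

∑∑-zero : ∀ m n → ∑[ a < m ] ∑[ b < n ] 0 ≡ 0
∑∑-zero m n = trans (∑-cong m (λ _ _ → ∑-zero n)) (∑-zero m)

-- In each summand of count-tiles-by-kind, adj' t and its converse pick out at most one
-- site; out-edge tests have the shape required by ∑∑-site on the nose, in-edge tests after
-- swapping the sides of each ≡ᵇ.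
module _ (m n : ℕ) (P : Tile → Bool) where

  count-out : ∀ t → count (λ u → adj' t u ∧ P u) (tiles m n) ≡ sum (map (ind ∘ occupied m n P) (outNeighbours t))
  count-out (sq , a , b) = trans (count-tiles-by-kind m n _)
    (cong₂ _+_ (∑∑-site m n P (suc (suc a)) (suc b) (λ _ _ → refl))
    (cong₂ _+_ (∑∑-site m n P (suc a) (suc b) (λ _ _ → refl)) (cong (_+ 0) (∑∑-zero m n))))
  count-out (up , a , b) = trans (count-tiles-by-kind m n _)
    (cong₂ _+_ (∑∑-zero m n) (cong₂ _+_ (∑∑-zero m n) (cong (_+ 0) (∑∑-site m n P (suc a) (suc b) (λ _ _ → refl)))))
  count-out (dn , a , b) = trans (count-tiles-by-kind m n _)
    (cong₂ _+_ (∑∑-site m n P (suc a) (suc (suc b)) (λ _ _ → refl))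
    (cong₂ _+_ (∑∑-site m n P (suc (suc a)) (suc b) (λ _ _ → refl)) (cong (_+ 0) (∑∑-zero m n))))

  count-in : ∀ t → count (λ u → adj' u t ∧ P u) (tiles m n) ≡ sum (map (ind ∘ occupied m n P) (inNeighbours t))
  count-in (sq , a , b) = trans (count-tiles-by-kind m n _)
    (cong₂ _+_ (∑∑-site m n P a (suc b) (λ a′ b′ → ∧-≡ᵇ-comm a (suc a′) b b′))
    (cong₂ _+_ (∑∑-zero m n) (cong (_+ 0) (∑∑-site m n P (suc a) b (λ a′ b′ → ∧-≡ᵇ-comm a a′ b (suc b′))))))
  count-in (up , a , b) = trans (count-tiles-by-kind m n _)
    (cong₂ _+_ (∑∑-site m n P (suc a) (suc b) (λ a′ b′ → ∧-≡ᵇ-comm a a′ b b′))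
    (cong₂ _+_ (∑∑-zero m n) (cong (_+ 0) (∑∑-site m n P a (suc b) (λ a′ b′ → ∧-≡ᵇ-comm a (suc a′) b b′)))))
  count-in (dn , a , b) = trans (count-tiles-by-kind m n _)
    (cong₂ _+_ (∑∑-zero m n)
    (cong₂ _+_ (∑∑-site m n P (suc a) (suc b) (λ a′ b′ → ∧-≡ᵇ-comm a a′ b b′)) (cong (_+ 0) (∑∑-zero m n))))

  count-neighbours : ∀ t → count (λ u → adj t u ∧ P u) (tiles m n) ≡ sum (map (ind ∘ occupied m n P) (neighbours t))
  count-neighbours t = begin
    count (λ u → adj t u ∧ P u) (tiles m n)
      ≡⟨ count-cong (λ u → ∧-distribʳ-∨ (P u) (adj' t u) (adj' u t)) (tiles m n) ⟩
    count (λ u → (adj' t u ∧ P u) ∨ (adj' u t ∧ P u)) (tiles m n)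
      ≡⟨ count-∨ (λ u tu ut → adj'-asym t u (proj₁ (to T-∧ tu)) (proj₁ (to T-∧ ut))) (tiles m n) ⟩
    count (λ u → adj' t u ∧ P u) (tiles m n) + count (λ u → adj' u t ∧ P u) (tiles m n)
      ≡⟨ cong₂ _+_ (count-out t) (count-in t) ⟩
    sum (map f (outNeighbours t)) + sum (map f (inNeighbours t))
      ≡⟨ sum-++ (map f (outNeighbours t)) _ ⟨
    sum (map f (outNeighbours t) ++ map f (inNeighbours t))
      ≡⟨ cong sum (map-++ f (outNeighbours t) _) ⟨
    sum (map f (neighbours t)) ∎
    where
    open ≡-Reasoning
    f : Tile → ℕ
    f = ind ∘ occupied m n P

degree≤ : ∀ m n t → degree m n t ≤ length (neighbours t)
degree≤ m n t = begin
  degree m n t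
    ≡⟨ count-cong (λ u → sym (∧-identityʳ (adj t u))) (tiles m n) ⟩
  count (λ u → adj t u ∧ true) (tiles m n)
    ≡⟨ count-neighbours m n (λ _ → true) t ⟩
  sum (map (ind ∘ occupied m n (λ _ → true)) (neighbours t))
    ≤⟨ sum-map-ind≤length _ (neighbours t) ⟩
  length (neighbours t) ∎
  where open ≤-Reasoning

HalfDependent⇒neighbours≤ : ∀ m n S → HalfDependent m n S → ∀ k a b →
  T (occupied m n S (k , suc a , suc b)) →
  sum (map (ind ∘ occupied m n S) (neighbours (k , a , b))) ≤ length (neighbours (k , a , b)) / 2
HalfDependent⇒neighbours≤ m n S hd k a b occ
  with a<m , b<n , St ← occupied⇒ m n S k a b occ = begin
  sum (map (ind ∘ occupied m n S) (neighbours (k , a , b)))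
    ≡⟨ count-neighbours m n S (k , a , b) ⟨
  count (λ u → adj (k , a , b) u ∧ S u) (tiles m n)
    ≤⟨ hd (k , a , b) (∈-tiles m n k a<m b<n) St ⟩
  degree m n (k , a , b) / 2
    ≤⟨ /-monoˡ-≤ 2 (degree≤ m n (k , a , b)) ⟩
  length (neighbours (k , a , b)) / 2 ∎
  where open ≤-Reasoning

∑∑-+ : ∀ m n (f g : ℕ → ℕ → ℕ) →
  ∑[ a < m ] ∑[ b < n ] (f a b + g a b) ≡ ∑[ a < m ] ∑[ b < n ] f a b + ∑[ a < m ] ∑[ b < n ] g a b
∑∑-+ m n f g = trans (∑-cong m (λ a _ → ∑-+ n (f a) (g a))) (∑-+ m _ _)

∑∑-*ˡ : ∀ m n w (f : ℕ → ℕ → ℕ) → ∑[ a < m ] ∑[ b < n ] (w * f a b) ≡ w * ∑[ a < m ] ∑[ b < n ] f a b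
∑∑-*ˡ m n w f = trans (∑-cong m (λ a _ → ∑-*ˡ n w (f a))) (∑-*ˡ m w _)

∑∑-const : ∀ m n c → ∑[ a < m ] ∑[ b < n ] c ≡ m * (n * c)
∑∑-const m n c = trans (∑-cong m (λ _ _ → ∑-const n c)) (∑-const m (n * c))

-- Cluster (a , b) receives e a b and v a b from its left and lower neighbours and sends
-- e (suc a) b and v a (suc b) on; only the flows entering the region are not cancelled.
grid-discharging : ∀ {w c E V} m n (q e v : ℕ → ℕ → ℕ) →
  (∀ b → e 0 b ≤ E) → (∀ a → v a 0 ≤ V) →
  (∀ a b → w * q a b + (e (suc a) b + v a (suc b)) ≤ c + (e a b + v a b)) →
  w * ∑[ a < m ] ∑[ b < n ] q a b ≤ m * (n * c) + (n * E + m * V)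
grid-discharging {w} {c} {E} {V} m n q e v e₀≤ v₀≤ balance =
  +-cancelʳ-≤ (Eₒ + Vₒ) (w * Q) (m * (n * c) + (n * E + m * V)) (begin
    w * Q + (Eₒ + Vₒ)
      ≡⟨ cong₂ _+_ (∑∑-*ˡ m n w q) (∑∑-+ m n _ _) ⟨
    ∑[ a < m ] ∑[ b < n ] (w * q a b) + ∑[ a < m ] ∑[ b < n ] (e (suc a) b + v a (suc b))
      ≡⟨ ∑∑-+ m n _ _ ⟨
    ∑[ a < m ] ∑[ b < n ] (w * q a b + (e (suc a) b + v a (suc b)))
      ≤⟨ ∑-mono m (λ a → ∑-mono n (balance a)) ⟩
    ∑[ a < m ] ∑[ b < n ] (c + (e a b + v a b))
      ≡⟨ trans (∑∑-+ m n _ _) (cong₂ _+_ (∑∑-const m n c) (∑∑-+ m n e v)) ⟩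
    m * (n * c) + (Eᵢ + Vᵢ)
      ≤⟨ +-monoʳ-≤ (m * (n * c)) (+-mono-≤ Eᵢ≤ Vᵢ≤) ⟩
    m * (n * c) + ((n * E + Eₒ) + (m * V + Vₒ))
      ≡⟨ cong (m * (n * c) +_) (interchange (n * E) Eₒ (m * V) Vₒ) ⟩
    m * (n * c) + ((n * E + m * V) + (Eₒ + Vₒ))
      ≡⟨ +-assoc (m * (n * c)) _ _ ⟨
    m * (n * c) + (n * E + m * V) + (Eₒ + Vₒ) ∎)
  where
  open ≤-Reasoning
  Q Eᵢ Eₒ Vᵢ Vₒ : ℕ
  Q  = ∑[ a < m ] ∑[ b < n ] q a b
  Eᵢ = ∑[ a < m ] ∑[ b < n ] e a b
  Eₒ = ∑[ a < m ] ∑[ b < n ] e (suc a) b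
  Vᵢ = ∑[ a < m ] ∑[ b < n ] v a b
  Vₒ = ∑[ a < m ] ∑[ b < n ] v a (suc b)
  Eᵢ≤ : Eᵢ ≤ n * E + Eₒ
  Eᵢ≤ = begin
    Eᵢ                           ≤⟨ ∑-≤-shift m (λ a → ∑< n (e a)) ⟩
    ∑[ b < n ] e 0 b + Eₒ        ≤⟨ +-monoˡ-≤ Eₒ (∑-mono n e₀≤) ⟩
    ∑[ b < n ] E + Eₒ            ≡⟨ cong (_+ Eₒ) (∑-const n E) ⟩
    n * E + Eₒ                   ∎
  Vᵢ≤ : Vᵢ ≤ m * V + Vₒ
  Vᵢ≤ = begin
    Vᵢ                                           ≤⟨ ∑-mono m (λ a → ∑-≤-shift n (v a)) ⟩
    ∑[ a < m ] (v a 0 + ∑[ b < n ] v a (suc b))  ≡⟨ ∑-+ m (λ a → v a 0) _ ⟩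
    ∑[ a < m ] v a 0 + Vₒ                        ≤⟨ +-monoˡ-≤ Vₒ (∑-mono m v₀≤) ⟩
    ∑[ a < m ] V + Vₒ                            ≡⟨ cong (_+ Vₒ) (∑-const m V) ⟩
    m * V + Vₒ                                   ∎

-- Flows across the edges leaving a cluster, in terms of membership in S of the tile they
-- leave from (and, between two squares, of the square they enter): squareFlow from a
-- square to the square on its right, diagonalFlow from a down triangle to the up triangle
-- on its right, verticalFlow from a down triangle to the square above it.
squareFlow : Bool → Bool → ℕ
squareFlow false _     = 6
squareFlow true  false = 0
squareFlow true  true  = 3

diagonalFlow : Bool → ℕ
diagonalFlow false = 9
diagonalFlow true  = 0

verticalFlow : Bool → ℕ
verticalFlow false = 8
verticalFlow true  = 5

∀-Bool? : {P : Bool → Set} → (∀ b → Dec (P b)) → Dec (∀ b → P b)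
∀-Bool? P? = map′ (λ { (pt , pf) true → pt ; (pt , pf) false → pf }) (λ h → h true , h false)
                  (P? true ×-dec P? false)

-- x, u, d: the cluster; L, R: the squares to its left and right; dl: the down triangle to
-- the left of u; db: the down triangle below x.
Balanced : (x u d L R db dl : Bool) → Set
Balanced x u d L R db dl =
  (T x → sum (map ind (R ∷ u ∷ L ∷ db ∷ [])) ≤ 2) →
  (T u → sum (map ind (d ∷ x ∷ dl ∷ [])) ≤ 1) →
  21 * sum (map ind (x ∷ u ∷ d ∷ [])) + ((squareFlow x R + diagonalFlow d) + verticalFlow d)
    ≤ 39 + ((squareFlow L x + diagonalFlow dl) + verticalFlow db)

balanced? : ∀ x u d L R db dl → Dec (Balanced x u d L R db dl)
balanced? x u d L R db dl = (T? x →-dec _ ≤? 2) →-dec (T? u →-dec _ ≤? 1) →-dec _ ≤? _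

cluster-balance : ∀ x u d L R db dl → Balanced x u d L R db dl
cluster-balance = from-yes
  (∀-Bool? λ x → ∀-Bool? λ u → ∀-Bool? λ d → ∀-Bool? λ L → ∀-Bool? λ R → ∀-Bool? λ db → ∀-Bool? λ dl →
    balanced? x u d L R db dl)

verticalFlow≤8 : ∀ x → verticalFlow x ≤ 8
verticalFlow≤8 false = ≤-refl
verticalFlow≤8 true  = m≤m+n 5 3

half-dependent-bound : ∀ m n S → HalfDependent m n S → 21 * card m n S ≤ m * (n * 39) + (n * 15 + m * 8)
half-dependent-bound m n S hd = begin
  21 * card m n S
    ≡⟨ cong (21 *_) card≡ ⟩
  21 * ∑[ a < m ] ∑[ b < n ] charge a b
    ≤⟨ grid-discharging {21} {39} {15} {8} m n charge east north
         (λ _ → ≤-refl) (λ _ → verticalFlow≤8 _) balance ⟩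
  m * (n * 39) + (n * 15 + m * 8) ∎
  where
  open ≤-Reasoning
  occ : Tile → Bool
  occ = occupied m n S
  charge east north : ℕ → ℕ → ℕ
  charge a b = sum (map (ind ∘ occ) (cluster (suc a) (suc b)))
  -- east 0 b is 6 + 9 exactly, as nothing lies left of the region.
  east   a b = squareFlow (occ (sq , a , suc b)) (occ (sq , suc a , suc b)) + diagonalFlow (occ (dn , a , suc b))
  north  a b = verticalFlow (occ (dn , suc a , b))
  balance : ∀ a b → 21 * charge a b + (east (suc a) b + north a (suc b)) ≤ 39 + (east a b + north a b)
  balance a b = cluster-balance
    (occ (sq , suc a , suc b)) (occ (up , suc a , suc b)) (occ (dn , suc a , suc b))
    (occ (sq , a , suc b)) (occ (sq , suc (suc a) , suc b)) (occ (dn , suc a , b)) (occ (dn , a , suc b))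
    (HalfDependent⇒neighbours≤ m n S hd sq a b) (HalfDependent⇒neighbours≤ m n S hd up a b)
  card≡ : card m n S ≡ ∑[ a < m ] ∑[ b < n ] charge a b
  card≡ = trans (count-tiles m n S) (∑-cong m (λ a a<m → ∑-cong n (λ b b<n →
    trans (count-as-sum S (cluster a b))
          (cong sum (map-cong (λ k → cong ind (sym (occupied-inside m n S k a<m b<n))) kinds)))))

density-arithmetic : ∀ K m n s → 15 * K ≤ m → 15 * K ≤ n →
  21 * s ≤ m * (n * 39) + (n * 15 + m * 8) → 21 * K * s ≤ (13 * K + 21) * (m * (n * 3))
density-arithmetic K m n s 15K≤m 15K≤n 21s≤ = begin
  21 * K * s
    ≡⟨ solve (K ∷ s ∷ []) ⟩
  K * (21 * s)
    ≤⟨ *-monoʳ-≤ K 21s≤ ⟩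
  K * (m * (n * 39) + (n * 15 + m * 8))
    ≡⟨ solve (K ∷ m ∷ n ∷ []) ⟩
  13 * K * (m * (n * 3)) + (15 * K * n + 8 * K * m)
    ≤⟨ +-monoʳ-≤ (13 * K * (m * (n * 3))) boundary≤ ⟩
  13 * K * (m * (n * 3)) + (m * n + n * m + 61 * (m * n))
    ≡⟨ solve (K ∷ m ∷ n ∷ []) ⟩
  (13 * K + 21) * (m * (n * 3)) ∎
  where
  open ≤-Reasoning
  8K≤n : 8 * K ≤ n
  8K≤n = ≤-trans (*-monoˡ-≤ K (m≤m+n 8 7)) 15K≤n
  boundary≤ : 15 * K * n + 8 * K * m ≤ m * n + n * m + 61 * (m * n)
  boundary≤ = ≤-trans (+-mono-≤ (*-monoˡ-≤ n 15K≤m) (*-monoˡ-≤ m 8K≤n)) (m≤m+n _ _)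

theorem3p1 : ∀ (k : ℕ) → ∃[ N ] ∀ (m n : ℕ) → m ≥ N → n ≥ N →
    ∀ (S : Tile → Bool) → HalfDependent m n S →
      21 * suc k * card m n S ≤ (13 * suc k + 21) * length (tiles m n)
theorem3p1 k = 15 * suc k , λ m n m≥N n≥N S hd →
  subst (λ l → 21 * suc k * card m n S ≤ (13 * suc k + 21) * l) (sym (length-tiles m n))
    (density-arithmetic (suc k) m n (card m n S) m≥N n≥N (half-dependent-bound m n S hd))
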